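{- Let $M=x^2+x+1\in\mathbb{F}_2[x]$, $r\ge1$, $0\le j\le 2^{r-1}-1$, and $A=M^{2^r-j}+1$. Then $\ell_A=j+1$.
   Context: For nonzero $A\in\mathbb{F}_2[x]$, the Collatz transformations are: $A_0=A$, and for $k\ge0$, $A_{2k+1}=A_{2k}/(x^{a_{2k}}(x+1)^{b_{2k}})$ where $a_{2k},b_{2k}$ are the multiplicities of $x$ and $x+1$ in $A_{2k}$, and $A_{2k+2}=1+MA_{2k+1}$. The length $\ell_A$ is $1+\min\{k\ge0: A_{2k+1}=1\}$, i.e. the number of terms of the sequence $A_1,A_3,A_5,\dots$ up to and including its first term equal to $1$. -}

module Defs where

open import Data.Bool using (Bool; true; false; _xor_; if_then_else_)
open import Data.List using (List; []; _∷_; length)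
open import Data.Nat using (ℕ; zero; suc; _<_)
open import Relation.Binary.PropositionalEquality using (_≡_; _≢_)
open import Data.Product using (_×_)
open import Data.Empty using (⊥)

-- Polynomials over F₂ as coefficient lists, constant term first.
-- All operations below return *normalised* lists (no trailing `false`),
-- so polynomial equality is propositional equality of normalised lists.
Poly : Set
Poly = List Bool

norm : Poly → Poly
norm [] = []
norm (a ∷ p) with norm p
... | [] = if a then true ∷ [] else []
... | r  = a ∷ r

addRaw : Poly → Poly → Poly
addRaw [] q = q
addRaw (a ∷ p) [] = a ∷ p
addRaw (a ∷ p) (b ∷ q) = (a xor b) ∷ addRaw p q

_⊕_ : Poly → Poly → Poly
p ⊕ q = norm (addRaw p q)

mulRaw : Poly → Poly → Poly
mulRaw [] q = []
mulRaw (a ∷ p) q = addRaw (if a then q else []) (false ∷ mulRaw p q)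

_⊗_ : Poly → Poly → Poly
p ⊗ q = norm (mulRaw p q)

one : Poly
one = true ∷ []

M : Poly
M = true ∷ true ∷ true ∷ []

_^ᵖ_ : Poly → ℕ → Poly
p ^ᵖ zero = one
p ^ᵖ suc n = p ⊗ (p ^ᵖ n)

-- value at x = 1 (false iff (x+1) divides p)
eval1 : Poly → Bool
eval1 [] = false
eval1 (a ∷ p) = a xor eval1 p

-- quotient of p by (x+1) when (x+1) ∣ p : q_i = p_0 + ... + p_i
prefixXor : Bool → Poly → Poly
prefixXor c [] = []
prefixXor c (a ∷ p) = (c xor a) ∷ prefixXor (c xor a) p

divX+1 : Poly → Poly
divX+1 p = norm (prefixXor false p)

-- Remove all factors x and x+1 from a (normalised) polynomial.
-- Each division lowers the degree by one, so `length p` fuel suffices.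
stripFuel : ℕ → Poly → Poly
stripFuel zero p = p
stripFuel (suc n) [] = []
stripFuel (suc n) (false ∷ p) = stripFuel n p
stripFuel (suc n) (true ∷ p) with eval1 (true ∷ p)
... | false = stripFuel n (divX+1 (true ∷ p))
... | true  = true ∷ p

oddPart : Poly → Poly
oddPart p = stripFuel (length (norm p)) (norm p)

-- Even-indexed terms: A_0 = A, A_{2k+2} = 1 + M A_{2k+1}
collatzEven : Poly → ℕ → Poly
collatzEven A zero = norm A
collatzEven A (suc k) = one ⊕ (M ⊗ oddPart (collatzEven A k))

-- Odd-indexed terms: A_{2k+1}
collatzOdd : Poly → ℕ → Poly
collatzOdd A k = oddPart (collatzEven A k)

-- ℓ_A = L  iff  L = 1 + min { k : A_{2k+1} = 1 }
LengthIs : Poly → ℕ → Set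
LengthIs A zero = ⊥
LengthIs A (suc m) = (collatzOdd A m ≡ one) × (∀ k → k < m → collatzOdd A k ≢ one)

-- Over F₂ we have M = 1 + D with D = x (x + 1), so Frobenius gives M^(2^v) = 1 + D^(2^v).
-- For n = 2^v (2t + 1) with t ≥ 1 this yields M^n + 1 = D^(2^v) (1 + D^(2^v) R) with R ≠ 0.
-- As 1 + M (1 + M^k D^(e+1) R) = D (1 + M^(k+1) D^e R), the next 2^v odd terms of the orbit
-- are 1 + M^k D^(2^v − k) R, none equal to 1, and then the orbit joins that of
-- M^(n + 2^v) + 1; hence ℓ(M^n + 1) = 2^v + ℓ(M^(n + 2^v) + 1). Since M^(2^r) + 1 = D^(2^r)
-- has length 1, peeling off the binary digits of j gives ℓ(M^(2^r − j) + 1) = j + 1.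
module Submission where

open import Algebra.Bundles using (CommutativeRing)
import Algebra.Properties.Semiring.Exp as SemiringExp
open import Algebra.Solver.Ring.AlmostCommutativeRing using (fromCommutativeRing)
import Algebra.Solver.Ring.Simple as RingSolver
import Relation.Binary.Reasoning.Setoid
open import Data.Bool using (Bool; true; false; _xor_; _∧_; if_then_else_)
import Data.Bool.Properties as Bool
open import Data.Bool.Solver using (module xor-∧-Solver)
open import Algebra.Properties.CommutativeSemigroup
  (CommutativeRing.+-commutativeSemigroup Bool.xor-∧-commutativeRing)
  using () renaming (interchange to xor-interchange)
open import Data.Empty using (⊥-elim)
open import Data.List using ([]; _∷_; length)
import Data.List.Properties as List
open import Data.Nat using (ℕ; zero; suc; _+_; _*_; _^_; _∸_; _≤_; _<_; _<?_; z≤n; s≤s)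
import Data.Nat.Properties as ℕ
open import Data.Nat.Solver using (module +-*-Solver)
open import Data.Product using (_×_; _,_; proj₁; proj₂)
open import Relation.Binary.Bundles using (Setoid)
open import Relation.Binary.Structures using (IsEquivalence)
open import Relation.Binary.PropositionalEquality
  using (_≡_; _≢_; refl; sym; trans; cong; cong₂; subst; subst₂; module ≡-Reasoning)
open import Relation.Nullary using (¬_; Dec; yes; no)

open import Defs

-- The ring F₂[x]

data IsZero : Poly → Set where
  []      : IsZero []
  false∷_ : ∀ {p} → IsZero p → IsZero (false ∷ p)

infix 4 _≈_

-- Equality of coefficient lists up to trailing zeros, i.e. equality in F₂[x].
data _≈_ : Poly → Poly → Set where
  []≈  : ∀ {q} → IsZero q → [] ≈ q
  ≈[]  : ∀ {p} → IsZero p → p ≈ []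
  cons : ∀ {a p q} → p ≈ q → a ∷ p ≈ a ∷ q

≈-refl : ∀ {p} → p ≈ p
≈-refl {[]}    = []≈ []
≈-refl {a ∷ p} = cons ≈-refl

≈-sym : ∀ {p q} → p ≈ q → q ≈ p
≈-sym ([]≈ z) = ≈[] z
≈-sym (≈[] z) = []≈ z
≈-sym (cons e) = cons (≈-sym e)

IsZero-resp-≈ : ∀ {p q} → IsZero p → p ≈ q → IsZero q
IsZero-resp-≈ z ([]≈ z′) = z′
IsZero-resp-≈ z (≈[] _) = []
IsZero-resp-≈ (false∷ z) (cons e) = false∷ IsZero-resp-≈ z e

IsZero⇒≈ : ∀ {p q} → IsZero p → IsZero q → p ≈ q
IsZero⇒≈ [] zq = []≈ zq
IsZero⇒≈ (false∷ zp) [] = ≈[] (false∷ zp)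
IsZero⇒≈ (false∷ zp) (false∷ zq) = cons (IsZero⇒≈ zp zq)

≈-trans : ∀ {p q r} → p ≈ q → q ≈ r → p ≈ r
≈-trans ([]≈ z) e = []≈ (IsZero-resp-≈ z e)
≈-trans (≈[] z) ([]≈ z′) = IsZero⇒≈ z z′
≈-trans (≈[] z) (≈[] _) = ≈[] z
≈-trans (cons e) (≈[] (false∷ z)) = ≈[] (false∷ IsZero-resp-≈ z (≈-sym e))
≈-trans (cons e) (cons e′) = cons (≈-trans e e′)

≈-isEquivalence : IsEquivalence _≈_
≈-isEquivalence = record { refl = ≈-refl ; sym = ≈-sym ; trans = ≈-trans }

≈-setoid : Setoid _ _
≈-setoid = record { isEquivalence = ≈-isEquivalence }

module ≈-Reasoning = Relation.Binary.Reasoning.Setoid ≈-setoid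

≡⇒≈ : ∀ {p q} → p ≡ q → p ≈ q
≡⇒≈ refl = ≈-refl

infixr 5 _∷⁺_

_∷⁺_ : Bool → Poly → Poly
a ∷⁺ [] = if a then one else []
a ∷⁺ (b ∷ p) = a ∷ b ∷ p

norm-∷ : ∀ a p → norm (a ∷ p) ≡ a ∷⁺ norm p
norm-∷ a p with norm p
... | []    = refl
... | _ ∷ _ = refl

∷⁺≈∷ : ∀ a p → a ∷⁺ p ≈ a ∷ p
∷⁺≈∷ true  []      = ≈-refl
∷⁺≈∷ false []      = []≈ (false∷ [])
∷⁺≈∷ a     (_ ∷ _) = ≈-refl

norm≈ : ∀ p → norm p ≈ p
norm≈ [] = ≈-refl
norm≈ (a ∷ p) rewrite norm-∷ a p = ≈-trans (∷⁺≈∷ a (norm p)) (cons (norm≈ p))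

IsZero⇒norm≡[] : ∀ {p} → IsZero p → norm p ≡ []
IsZero⇒norm≡[] [] = refl
IsZero⇒norm≡[] (false∷_ {p} z) rewrite norm-∷ false p | IsZero⇒norm≡[] z = refl

≈⇒norm≡ : ∀ {p q} → p ≈ q → norm p ≡ norm q
≈⇒norm≡ ([]≈ z) = sym (IsZero⇒norm≡[] z)
≈⇒norm≡ (≈[] z) = IsZero⇒norm≡[] z
≈⇒norm≡ (cons {a} {p} {q} e) rewrite norm-∷ a p | norm-∷ a q = cong (a ∷⁺_) (≈⇒norm≡ e)

norm≡⇒≈ : ∀ {p q} → norm p ≡ norm q → p ≈ q
norm≡⇒≈ {p} {q} e = ≈-trans (≈-sym (norm≈ p)) (subst (_≈ q) (sym e) (norm≈ q))

norm-idem : ∀ p → norm (norm p) ≡ norm p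
norm-idem p = ≈⇒norm≡ (norm≈ p)

_≈?_ : ∀ p q → Dec (p ≈ q)
p ≈? q with List.≡-dec Bool._≟_ (norm p) (norm q)
... | yes e = yes (norm≡⇒≈ e)
... | no ¬e = no λ e → ¬e (≈⇒norm≡ e)

addRaw-zeroˡ : ∀ {z} q → IsZero z → addRaw z q ≈ q
addRaw-zeroˡ q [] = ≈-refl
addRaw-zeroˡ [] (false∷ z) = ≈[] (false∷ z)
addRaw-zeroˡ (_ ∷ q) (false∷ z) = cons (addRaw-zeroˡ q z)

addRaw-comm : ∀ p q → addRaw p q ≡ addRaw q p
addRaw-comm [] [] = refl
addRaw-comm [] (_ ∷ _) = refl
addRaw-comm (_ ∷ _) [] = refl
addRaw-comm (a ∷ p) (b ∷ q) = cong₂ _∷_ (Bool.xor-comm a b) (addRaw-comm p q)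

addRaw-zeroʳ : ∀ {z} q → IsZero z → addRaw q z ≈ q
addRaw-zeroʳ {z} q z-zero rewrite addRaw-comm q z = addRaw-zeroˡ q z-zero

addRaw-identityʳ : ∀ p → addRaw p [] ≡ p
addRaw-identityʳ [] = refl
addRaw-identityʳ (_ ∷ _) = refl

addRaw-assoc : ∀ p q r → addRaw (addRaw p q) r ≡ addRaw p (addRaw q r)
addRaw-assoc [] q r = refl
addRaw-assoc (_ ∷ _) [] r = refl
addRaw-assoc (_ ∷ _) (_ ∷ _) [] = refl
addRaw-assoc (a ∷ p) (b ∷ q) (c ∷ r) = cong₂ _∷_ (Bool.xor-assoc a b c) (addRaw-assoc p q r)

addRaw-self : ∀ p → IsZero (addRaw p p)
addRaw-self [] = []
addRaw-self (a ∷ p) rewrite Bool.xor-same a = false∷ addRaw-self p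

addRaw-cong : ∀ {p p′ q q′} → p ≈ p′ → q ≈ q′ → addRaw p q ≈ addRaw p′ q′
addRaw-cong {q′ = q′} ([]≈ z) e = ≈-trans e (≈-sym (addRaw-zeroˡ q′ z))
addRaw-cong {q = q} (≈[] z) e = ≈-trans (addRaw-zeroˡ q z) e
addRaw-cong {p′ = p′} e@(cons _) ([]≈ z) = ≈-trans e (≈-sym (addRaw-zeroʳ p′ z))
addRaw-cong {p = p} e@(cons _) (≈[] z) = ≈-trans (addRaw-zeroʳ p z) e
addRaw-cong (cons e) (cons e′) = cons (addRaw-cong e e′)

addRaw-interchange : ∀ p q r s → addRaw (addRaw p q) (addRaw r s) ≡ addRaw (addRaw p r) (addRaw q s)
addRaw-interchange p q r s = begin
  addRaw (addRaw p q) (addRaw r s) ≡⟨ addRaw-assoc p q (addRaw r s) ⟩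
  addRaw p (addRaw q (addRaw r s)) ≡⟨ cong (addRaw p) (sym (addRaw-assoc q r s)) ⟩
  addRaw p (addRaw (addRaw q r) s) ≡⟨ cong (λ t → addRaw p (addRaw t s)) (addRaw-comm q r) ⟩
  addRaw p (addRaw (addRaw r q) s) ≡⟨ cong (addRaw p) (addRaw-assoc r q s) ⟩
  addRaw p (addRaw r (addRaw q s)) ≡⟨ addRaw-assoc p r (addRaw q s) ⟨
  addRaw (addRaw p r) (addRaw q s) ∎
  where open ≡-Reasoning

scale : Bool → Poly → Poly
scale a q = if a then q else []

scale-xor : ∀ a b r → scale (a xor b) r ≈ addRaw (scale a r) (scale b r)
scale-xor true  true  r = []≈ (addRaw-self r)
scale-xor true  false r rewrite addRaw-identityʳ r = ≈-refl
scale-xor false b     r = ≈-refl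

mulRaw-zeroˡ : ∀ {z} q → IsZero z → IsZero (mulRaw z q)
mulRaw-zeroˡ q [] = []
mulRaw-zeroˡ q (false∷ z) = false∷ mulRaw-zeroˡ q z

mulRaw-zeroʳ : ∀ p → IsZero (mulRaw p [])
mulRaw-zeroʳ [] = []
mulRaw-zeroʳ (true  ∷ p) = false∷ mulRaw-zeroʳ p
mulRaw-zeroʳ (false ∷ p) = false∷ mulRaw-zeroʳ p

mulRaw-congˡ : ∀ {p p′} q → p ≈ p′ → mulRaw p q ≈ mulRaw p′ q
mulRaw-congˡ q ([]≈ z) = []≈ (mulRaw-zeroˡ q z)
mulRaw-congˡ q (≈[] z) = ≈[] (mulRaw-zeroˡ q z)
mulRaw-congˡ q (cons {a} e) = addRaw-cong (≈-refl {scale a q}) (cons (mulRaw-congˡ q e))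

mulRaw-distribʳ : ∀ p q r → mulRaw (addRaw p q) r ≈ addRaw (mulRaw p r) (mulRaw q r)
mulRaw-distribʳ [] q r = ≈-refl
mulRaw-distribʳ (a ∷ p) [] r rewrite addRaw-identityʳ (mulRaw (a ∷ p) r) = ≈-refl
mulRaw-distribʳ (a ∷ p) (b ∷ q) r
  rewrite addRaw-interchange (scale a r) (false ∷ mulRaw p r) (scale b r) (false ∷ mulRaw q r)
  = addRaw-cong (scale-xor a b r) (cons (mulRaw-distribʳ p q r))

mulRaw-∷ʳ : ∀ p b q → mulRaw p (b ∷ q) ≈ addRaw (scale b p) (false ∷ mulRaw p q)
mulRaw-∷ʳ [] true  q = []≈ (false∷ [])
mulRaw-∷ʳ [] false q = []≈ (false∷ [])
mulRaw-∷ʳ (a ∷ p) b q =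
  ≈-trans (addRaw-cong (≈-refl {scale a (b ∷ q)}) (cons (mulRaw-∷ʳ p b q))) (swap a b)
  where
  pq : Poly
  pq = mulRaw p q
  swap : ∀ a b → addRaw (scale a (b ∷ q)) (false ∷ addRaw (scale b p) (false ∷ pq))
               ≈ addRaw (scale b (a ∷ p)) (false ∷ addRaw (scale a q) (false ∷ pq))
  swap true true
    rewrite sym (addRaw-assoc q p (false ∷ pq)) | addRaw-comm q p | addRaw-assoc p q (false ∷ pq)
    = ≈-refl
  swap true  false rewrite addRaw-identityʳ (false ∷ pq) = ≈-refl
  swap false true  = ≈-refl
  swap false false = ≈-refl

mulRaw-comm : ∀ p q → mulRaw p q ≈ mulRaw q p
mulRaw-comm [] q = []≈ (mulRaw-zeroʳ q)
mulRaw-comm (a ∷ p) q =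
  ≈-trans (addRaw-cong (≈-refl {scale a q}) (cons (mulRaw-comm p q))) (≈-sym (mulRaw-∷ʳ q a p))

mulRaw-congʳ : ∀ p {q q′} → q ≈ q′ → mulRaw p q ≈ mulRaw p q′
mulRaw-congʳ p {q} {q′} e =
  ≈-trans (mulRaw-comm p q) (≈-trans (mulRaw-congˡ p e) (mulRaw-comm q′ p))

mulRaw-assoc : ∀ p q r → mulRaw (mulRaw p q) r ≈ mulRaw p (mulRaw q r)
mulRaw-assoc [] q r = ≈-refl
mulRaw-assoc (a ∷ p) q r =
  ≈-trans (mulRaw-distribʳ (scale a q) (false ∷ mulRaw p q) r)
          (addRaw-cong (scale-mulRaw a) (cons (mulRaw-assoc p q r)))
  where
  scale-mulRaw : ∀ a → mulRaw (scale a q) r ≈ scale a (mulRaw q r)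
  scale-mulRaw true  = ≈-refl
  scale-mulRaw false = ≈-refl

⊕≈addRaw : ∀ p q → p ⊕ q ≈ addRaw p q
⊕≈addRaw p q = norm≈ (addRaw p q)

⊗≈mulRaw : ∀ p q → p ⊗ q ≈ mulRaw p q
⊗≈mulRaw p q = norm≈ (mulRaw p q)

⊕-cong : ∀ {p p′ q q′} → p ≈ p′ → q ≈ q′ → p ⊕ q ≈ p′ ⊕ q′
⊕-cong e e′ = ≡⇒≈ (≈⇒norm≡ (addRaw-cong e e′))

⊗-cong : ∀ {p p′ q q′} → p ≈ p′ → q ≈ q′ → p ⊗ q ≈ p′ ⊗ q′
⊗-cong {p′ = p′} {q} e e′ =
  ≡⇒≈ (≈⇒norm≡ (≈-trans (mulRaw-congˡ q e) (mulRaw-congʳ p′ e′)))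

⊕-comm : ∀ p q → p ⊕ q ≈ q ⊕ p
⊕-comm p q = ≡⇒≈ (cong norm (addRaw-comm p q))

⊕-assoc : ∀ p q r → (p ⊕ q) ⊕ r ≈ p ⊕ (q ⊕ r)
⊕-assoc p q r = begin
  (p ⊕ q) ⊕ r               ≈⟨ ⊕≈addRaw (p ⊕ q) r ⟩
  addRaw (p ⊕ q) r          ≈⟨ addRaw-cong (⊕≈addRaw p q) ≈-refl ⟩
  addRaw (addRaw p q) r     ≡⟨ addRaw-assoc p q r ⟩
  addRaw p (addRaw q r)     ≈⟨ addRaw-cong ≈-refl (⊕≈addRaw q r) ⟨
  addRaw p (q ⊕ r)          ≈⟨ ⊕≈addRaw p (q ⊕ r) ⟨
  p ⊕ (q ⊕ r)               ∎
  where open ≈-Reasoning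

⊕-identityˡ : ∀ p → [] ⊕ p ≈ p
⊕-identityˡ p = ⊕≈addRaw [] p

⊕-identityʳ : ∀ p → p ⊕ [] ≈ p
⊕-identityʳ p = ≈-trans (⊕≈addRaw p []) (≡⇒≈ (addRaw-identityʳ p))

⊕-self : ∀ p → p ⊕ p ≈ []
⊕-self p = ≈-trans (⊕≈addRaw p p) (≈[] (addRaw-self p))

⊗-comm : ∀ p q → p ⊗ q ≈ q ⊗ p
⊗-comm p q = ≡⇒≈ (≈⇒norm≡ (mulRaw-comm p q))

⊗-assoc : ∀ p q r → (p ⊗ q) ⊗ r ≈ p ⊗ (q ⊗ r)
⊗-assoc p q r = begin
  (p ⊗ q) ⊗ r               ≈⟨ ⊗≈mulRaw (p ⊗ q) r ⟩
  mulRaw (p ⊗ q) r          ≈⟨ mulRaw-congˡ r (⊗≈mulRaw p q) ⟩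
  mulRaw (mulRaw p q) r     ≈⟨ mulRaw-assoc p q r ⟩
  mulRaw p (mulRaw q r)     ≈⟨ mulRaw-congʳ p (⊗≈mulRaw q r) ⟨
  mulRaw p (q ⊗ r)          ≈⟨ ⊗≈mulRaw p (q ⊗ r) ⟨
  p ⊗ (q ⊗ r)               ∎
  where open ≈-Reasoning

⊗-identityˡ : ∀ p → one ⊗ p ≈ p
⊗-identityˡ p = ≈-trans (⊗≈mulRaw one p) (addRaw-zeroʳ p (false∷ []))

⊗-identityʳ : ∀ p → p ⊗ one ≈ p
⊗-identityʳ p = ≈-trans (⊗-comm p one) (⊗-identityˡ p)

⊗-distribʳ : ∀ p q r → (q ⊕ r) ⊗ p ≈ (q ⊗ p) ⊕ (r ⊗ p)
⊗-distribʳ p q r = begin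
  (q ⊕ r) ⊗ p                          ≈⟨ ⊗≈mulRaw (q ⊕ r) p ⟩
  mulRaw (q ⊕ r) p                     ≈⟨ mulRaw-congˡ p (⊕≈addRaw q r) ⟩
  mulRaw (addRaw q r) p                ≈⟨ mulRaw-distribʳ q r p ⟩
  addRaw (mulRaw q p) (mulRaw r p)     ≈⟨ addRaw-cong (⊗≈mulRaw q p) (⊗≈mulRaw r p) ⟨
  addRaw (q ⊗ p) (r ⊗ p)               ≈⟨ ⊕≈addRaw (q ⊗ p) (r ⊗ p) ⟨
  (q ⊗ p) ⊕ (r ⊗ p)                    ∎
  where open ≈-Reasoning

⊗-distribˡ : ∀ p q r → p ⊗ (q ⊕ r) ≈ (p ⊗ q) ⊕ (p ⊗ r)
⊗-distribˡ p q r = begin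
  p ⊗ (q ⊕ r)          ≈⟨ ⊗-comm p (q ⊕ r) ⟩
  (q ⊕ r) ⊗ p          ≈⟨ ⊗-distribʳ p q r ⟩
  (q ⊗ p) ⊕ (r ⊗ p)    ≈⟨ ⊕-cong (⊗-comm q p) (⊗-comm r p) ⟩
  (p ⊗ q) ⊕ (p ⊗ r)    ∎
  where open ≈-Reasoning

⊕-cancelˡ : ∀ p q → p ⊕ q ≈ p → q ≈ []
⊕-cancelˡ p q e = begin
  q                ≈⟨ ⊕-identityˡ q ⟨
  [] ⊕ q           ≈⟨ ⊕-cong (⊕-self p) ≈-refl ⟨
  (p ⊕ p) ⊕ q      ≈⟨ ⊕-assoc p p q ⟩
  p ⊕ (p ⊕ q)      ≈⟨ ⊕-cong (≈-refl {p}) e ⟩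
  p ⊕ p            ≈⟨ ⊕-self p ⟩
  []               ∎
  where open ≈-Reasoning

F₂[x] : CommutativeRing _ _
F₂[x] = record
  { Carrier = Poly ; _≈_ = _≈_ ; _+_ = _⊕_ ; _*_ = _⊗_ ; -_ = λ p → p ; 0# = [] ; 1# = one
  ; isCommutativeRing = record
    { isRing = record
      { +-isAbelianGroup = record
        { isGroup = record
          { isMonoid = record
            { isSemigroup = record
              { isMagma = record { isEquivalence = ≈-isEquivalence ; ∙-cong = ⊕-cong }
              ; assoc = ⊕-assoc }
            ; identity = ⊕-identityˡ , ⊕-identityʳ }
          ; inverse = ⊕-self , ⊕-self
          ; ⁻¹-cong = λ e → e }
        ; comm = ⊕-comm }
      ; *-cong = ⊗-cong
      ; *-assoc = ⊗-assoc
      ; *-identity = ⊗-identityˡ , ⊗-identityʳ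
      ; distrib = ⊗-distribˡ , ⊗-distribʳ }
    ; *-comm = ⊗-comm } }

-- The solver's coefficients are elements of F₂[x] itself, so it normalises 1 + 1 to 0
-- and proves identities that hold only in characteristic 2.
module F₂[x]-Solver = RingSolver (fromCommutativeRing F₂[x]) _≈?_

open SemiringExp (CommutativeRing.semiring F₂[x]) using (^-assocʳ) renaming (_^_ to _^ʳ_)

^ᵖ≡^ʳ : ∀ p n → p ^ᵖ n ≡ p ^ʳ n
^ᵖ≡^ʳ p zero = refl
^ᵖ≡^ʳ p (suc n) = cong (p ⊗_) (^ᵖ≡^ʳ p n)

^ᵖ-assocʳ : ∀ p m n → (p ^ᵖ m) ^ᵖ n ≈ p ^ᵖ (m * n)
^ᵖ-assocʳ p m n rewrite ^ᵖ≡^ʳ (p ^ᵖ m) n | ^ᵖ≡^ʳ p m | ^ᵖ≡^ʳ p (m * n) = ^-assocʳ p m n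

^ᵖ-congˡ : ∀ {p q} n → p ≈ q → p ^ᵖ n ≈ q ^ᵖ n
^ᵖ-congˡ zero e = ≈-refl
^ᵖ-congˡ (suc n) e = ⊗-cong e (^ᵖ-congˡ n e)

one-^ᵖ : ∀ n → one ^ᵖ n ≈ one
one-^ᵖ zero = ≈-refl
one-^ᵖ (suc n) = ≈-trans (⊗-identityˡ (one ^ᵖ n)) (one-^ᵖ n)

^ᵖ-square : ∀ p → p ^ᵖ 2 ≈ p ⊗ p
^ᵖ-square p = ⊗-cong (≈-refl {p}) (⊗-identityʳ p)

^ᵖ-square-⊕ : ∀ p q → (p ⊕ q) ^ᵖ 2 ≈ (p ^ᵖ 2) ⊕ (q ^ᵖ 2)
^ᵖ-square-⊕ p q = begin
  (p ⊕ q) ^ᵖ 2             ≈⟨ ^ᵖ-square (p ⊕ q) ⟩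
  (p ⊕ q) ⊗ (p ⊕ q)
    ≈⟨ solve 2 (λ p q → (p :+ q) :* (p :+ q) := p :* p :+ q :* q) ≈-refl p q ⟩
  (p ⊗ p) ⊕ (q ⊗ q)        ≈⟨ ⊕-cong (^ᵖ-square p) (^ᵖ-square q) ⟨
  (p ^ᵖ 2) ⊕ (q ^ᵖ 2)      ∎
  where open ≈-Reasoning; open F₂[x]-Solver

frobenius : ∀ v p q → (p ⊕ q) ^ᵖ (2 ^ v) ≈ (p ^ᵖ (2 ^ v)) ⊕ (q ^ᵖ (2 ^ v))
frobenius zero p q = begin
  (p ⊕ q) ^ᵖ 1             ≈⟨ ⊗-identityʳ (p ⊕ q) ⟩
  p ⊕ q                    ≈⟨ ⊕-cong (⊗-identityʳ p) (⊗-identityʳ q) ⟨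
  (p ^ᵖ 1) ⊕ (q ^ᵖ 1)      ∎
  where open ≈-Reasoning
frobenius (suc v) p q = begin
  (p ⊕ q) ^ᵖ (2 * V)                     ≈⟨ ^ᵖ-assocʳ (p ⊕ q) 2 V ⟨
  ((p ⊕ q) ^ᵖ 2) ^ᵖ V                    ≈⟨ ^ᵖ-congˡ V (^ᵖ-square-⊕ p q) ⟩
  ((p ^ᵖ 2) ⊕ (q ^ᵖ 2)) ^ᵖ V             ≈⟨ frobenius v (p ^ᵖ 2) (q ^ᵖ 2) ⟩
  ((p ^ᵖ 2) ^ᵖ V) ⊕ ((q ^ᵖ 2) ^ᵖ V)      ≈⟨ ⊕-cong (^ᵖ-assocʳ p 2 V) (^ᵖ-assocʳ q 2 V) ⟩
  (p ^ᵖ (2 * V)) ⊕ (q ^ᵖ (2 * V))        ∎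
  where
  open ≈-Reasoning
  V : ℕ
  V = 2 ^ v

geometric : Poly → ℕ → Poly
geometric P zero    = []
geometric P (suc t) = one ⊕ (P ⊗ geometric P t)

geometric-sum : ∀ P t → (one ⊕ P) ⊗ geometric P t ≈ one ⊕ (P ^ᵖ t)
geometric-sum P zero = ≈-trans (⊗≈mulRaw (one ⊕ P) []) (≈[] (mulRaw-zeroʳ (one ⊕ P)))
geometric-sum P (suc t) = begin
  (one ⊕ P) ⊗ (one ⊕ (P ⊗ G))          ≈⟨ solve 2 (λ p g → (con one :+ p) :* (con one :+ p :* g)
                                                  := (con one :+ p) :+ p :* ((con one :+ p) :* g)) ≈-refl P G ⟩
  (one ⊕ P) ⊕ (P ⊗ ((one ⊕ P) ⊗ G))
    ≈⟨ ⊕-cong (≈-refl {one ⊕ P}) (⊗-cong (≈-refl {P}) (geometric-sum P t)) ⟩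
  (one ⊕ P) ⊕ (P ⊗ (one ⊕ (P ^ᵖ t)))   ≈⟨ solve 2 (λ p pᵗ → (con one :+ p) :+ p :* (con one :+ pᵗ)
                                                  := con one :+ p :* pᵗ) ≈-refl P (P ^ᵖ t) ⟩
  one ⊕ (P ⊗ (P ^ᵖ t))                 ∎
  where
  open ≈-Reasoning
  open F₂[x]-Solver
  G : Poly
  G = geometric P t

-- M = one ⊕ D holds by computation, so the ring solver may write M as 1 + D.
x x+1 D : Poly
x   = false ∷ true ∷ []
x+1 = true ∷ true ∷ []
D   = false ∷ true ∷ true ∷ []

-- Evaluation at 0, 1 and ω; nonzero polynomials

eval0 : Poly → Bool
eval0 []      = false
eval0 (a ∷ _) = a

eval0-resp-≈ : ∀ {p q} → p ≈ q → eval0 p ≡ eval0 q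
eval0-resp-≈ ([]≈ [])         = refl
eval0-resp-≈ ([]≈ (false∷ _)) = refl
eval0-resp-≈ (≈[] [])         = refl
eval0-resp-≈ (≈[] (false∷ _)) = refl
eval0-resp-≈ (cons _)         = refl

eval0-⊕ : ∀ p q → eval0 (p ⊕ q) ≡ eval0 p xor eval0 q
eval0-⊕ p q = trans (eval0-resp-≈ (⊕≈addRaw p q)) (raw p q)
  where
  raw : ∀ p q → eval0 (addRaw p q) ≡ eval0 p xor eval0 q
  raw []      q       = refl
  raw (a ∷ p) []      = sym (Bool.xor-identityʳ a)
  raw (a ∷ p) (b ∷ q) = refl

eval0-⊗ : ∀ p q → eval0 (p ⊗ q) ≡ eval0 p ∧ eval0 q
eval0-⊗ p q = trans (eval0-resp-≈ (⊗≈mulRaw p q)) (raw p q)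
  where
  raw : ∀ p q → eval0 (mulRaw p q) ≡ eval0 p ∧ eval0 q
  raw [] q = refl
  raw (true ∷ p) [] = refl
  raw (true ∷ p) (b ∷ q) = Bool.xor-identityʳ b
  raw (false ∷ p) q = refl

eval1-IsZero : ∀ {z} → IsZero z → eval1 z ≡ false
eval1-IsZero [] = refl
eval1-IsZero (false∷ z) = eval1-IsZero z

eval1-resp-≈ : ∀ {p q} → p ≈ q → eval1 p ≡ eval1 q
eval1-resp-≈ ([]≈ z) = sym (eval1-IsZero z)
eval1-resp-≈ (≈[] z) = eval1-IsZero z
eval1-resp-≈ (cons {a} e) = cong (a xor_) (eval1-resp-≈ e)

eval1-addRaw : ∀ p q → eval1 (addRaw p q) ≡ eval1 p xor eval1 q
eval1-addRaw [] q = refl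
eval1-addRaw (a ∷ p) [] = sym (Bool.xor-identityʳ _)
eval1-addRaw (a ∷ p) (b ∷ q) rewrite eval1-addRaw p q = xor-interchange a b (eval1 p) (eval1 q)

eval1-⊕ : ∀ p q → eval1 (p ⊕ q) ≡ eval1 p xor eval1 q
eval1-⊕ p q = trans (eval1-resp-≈ (⊕≈addRaw p q)) (eval1-addRaw p q)

eval1-⊗ : ∀ p q → eval1 (p ⊗ q) ≡ eval1 p ∧ eval1 q
eval1-⊗ p q = trans (eval1-resp-≈ (⊗≈mulRaw p q)) (raw p q)
  where
  scale-eval1 : ∀ a q → eval1 (scale a q) ≡ a ∧ eval1 q
  scale-eval1 true  q = refl
  scale-eval1 false q = refl
  raw : ∀ p q → eval1 (mulRaw p q) ≡ eval1 p ∧ eval1 q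
  raw [] q = refl
  raw (a ∷ p) q
    rewrite eval1-addRaw (scale a q) (false ∷ mulRaw p q) | scale-eval1 a q | raw p q
    = sym (Bool.∧-distribʳ-xor (eval1 q) a (eval1 p))

-- The field with four elements: (a , b) stands for a + b ω, where ω² = ω + 1.
F₄ : Set
F₄ = Bool × Bool

infixl 6 _+₄_
infixl 7 _·₄_

_+₄_ : F₄ → F₄ → F₄
(a , b) +₄ (c , d) = a xor c , b xor d

_·₄_ : F₄ → F₄ → F₄
(a , b) ·₄ (c , d) = (a ∧ c) xor (b ∧ d) , ((a ∧ d) xor (b ∧ c)) xor (b ∧ d)

ω : F₄
ω = false , true

-- ω is a root of M, so evaluation at ω vanishes on the multiples of M.
evalω : Poly → F₄
evalω []      = false , false
evalω (a ∷ p) = (a , false) +₄ ω ·₄ evalω p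

evalω-IsZero : ∀ {z} → IsZero z → evalω z ≡ (false , false)
evalω-IsZero [] = refl
evalω-IsZero (false∷ z) rewrite evalω-IsZero z = refl

evalω-resp-≈ : ∀ {p q} → p ≈ q → evalω p ≡ evalω q
evalω-resp-≈ ([]≈ z) = sym (evalω-IsZero z)
evalω-resp-≈ (≈[] z) = evalω-IsZero z
evalω-resp-≈ (cons {a} e) = cong (λ v → (a , false) +₄ ω ·₄ v) (evalω-resp-≈ e)

evalω-addRaw : ∀ p q → evalω (addRaw p q) ≡ evalω p +₄ evalω q
evalω-addRaw [] q = refl
evalω-addRaw (a ∷ p) [] = cong₂ _,_ (sym (Bool.xor-identityʳ _)) (sym (Bool.xor-identityʳ _))
evalω-addRaw (a ∷ p) (b ∷ q) rewrite evalω-addRaw p q =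
  cong₂ _,_ (xor-interchange a b (proj₂ (evalω p)) (proj₂ (evalω q)))
            (xor-interchange (proj₁ (evalω p)) (proj₁ (evalω q)) (proj₂ (evalω p)) (proj₂ (evalω q)))

evalω-⊕ : ∀ p q → evalω (p ⊕ q) ≡ evalω p +₄ evalω q
evalω-⊕ p q = trans (evalω-resp-≈ (⊕≈addRaw p q)) (evalω-addRaw p q)

evalω-⊗ : ∀ p q → evalω (p ⊗ q) ≡ evalω p ·₄ evalω q
evalω-⊗ p q = trans (evalω-resp-≈ (⊗≈mulRaw p q)) (raw p q)
  where
  open xor-∧-Solver
  scale₄ : Bool → F₄ → F₄
  scale₄ a (c , d) = a ∧ c , a ∧ d
  scale-evalω : ∀ a q → evalω (scale a q) ≡ scale₄ a (evalω q)
  scale-evalω true  q = refl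
  scale-evalω false q = refl
  raw : ∀ p q → evalω (mulRaw p q) ≡ evalω p ·₄ evalω q
  raw [] q = refl
  raw (a ∷ p) q
    rewrite evalω-addRaw (scale a q) (false ∷ mulRaw p q) | scale-evalω a q | raw p q
    = cong₂ _,_
        (solve 5 (λ a x₁ x₂ y₁ y₂ →
           a :* y₁ :+ (x₁ :* y₂ :+ x₂ :* y₁ :+ x₂ :* y₂)
           := (a :+ x₂) :* y₁ :+ (x₁ :+ x₂) :* y₂) refl a x₁ x₂ y₁ y₂)
        (solve 5 (λ a x₁ x₂ y₁ y₂ →
           a :* y₂ :+ (x₁ :* y₁ :+ x₂ :* y₂ :+ (x₁ :* y₂ :+ x₂ :* y₁ :+ x₂ :* y₂))
           := (a :+ x₂) :* y₂ :+ (x₁ :+ x₂) :* y₁ :+ (x₁ :+ x₂) :* y₂) refl a x₁ x₂ y₁ y₂)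
    where
    x₁ x₂ y₁ y₂ : Bool
    x₁ = proj₁ (evalω p)
    x₂ = proj₂ (evalω p)
    y₁ = proj₁ (evalω q)
    y₂ = proj₂ (evalω q)

evalω-M^ : ∀ n → 0 < n → evalω (M ^ᵖ n) ≡ (false , false)
evalω-M^ (suc n) _ = evalω-⊗ M (M ^ᵖ n)

infix 4 _≉0

_≉0 : Poly → Set
p ≉0 = ¬ (p ≈ [])

data Nonzero : Poly → Set where
  here  : ∀ {p} → Nonzero (true ∷ p)
  there : ∀ {p} → Nonzero p → Nonzero (false ∷ p)

Nonzero⇒≉0 : ∀ {p} → Nonzero p → p ≉0
Nonzero⇒≉0 here (≈[] ())
Nonzero⇒≉0 (there n) (≈[] (false∷ z)) = Nonzero⇒≉0 n (≈[] z)

≉0⇒Nonzero : ∀ p → p ≉0 → Nonzero p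
≉0⇒Nonzero [] p≉0 = ⊥-elim (p≉0 ≈-refl)
≉0⇒Nonzero (true  ∷ p) _ = here
≉0⇒Nonzero (false ∷ p) p≉0 =
  there (≉0⇒Nonzero p λ p≈0 → p≉0 (≈-trans (cons p≈0) (≈[] (false∷ []))))

Nonzero-resp-≈ : ∀ {p q} → Nonzero p → p ≈ q → Nonzero q
Nonzero-resp-≈ n e = ≉0⇒Nonzero _ λ q≈0 → Nonzero⇒≉0 n (≈-trans e q≈0)

-- The lowest terms of p and q multiply to the lowest term of p q.
Nonzero-mulRaw : ∀ {p q} → Nonzero p → Nonzero q → Nonzero (mulRaw p q)
Nonzero-mulRaw (there np) nq = there (Nonzero-mulRaw np nq)
Nonzero-mulRaw here here = here
Nonzero-mulRaw {true ∷ p} {false ∷ q} here (there nq) =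
  there (Nonzero-resp-≈ (Nonzero-mulRaw {true ∷ p} here nq)
                        (addRaw-cong (≈-refl {q}) (≈-sym (mulRaw-∷ʳ p false q))))

⊗-≉0 : ∀ {p q} → p ≉0 → q ≉0 → p ⊗ q ≉0
⊗-≉0 {p} {q} p≉0 q≉0 pq≈0 =
  Nonzero⇒≉0 (Nonzero-mulRaw (≉0⇒Nonzero p p≉0) (≉0⇒Nonzero q q≉0))
             (≈-trans (≈-sym (⊗≈mulRaw p q)) pq≈0)

^ᵖ-≉0 : ∀ {p} n → p ≉0 → p ^ᵖ n ≉0
^ᵖ-≉0 zero p≉0 = Nonzero⇒≉0 here
^ᵖ-≉0 (suc n) p≉0 = ⊗-≉0 p≉0 (^ᵖ-≉0 n p≉0)

M≉0 : M ≉0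
M≉0 = Nonzero⇒≉0 here

D≉0 : D ≉0
D≉0 = Nonzero⇒≉0 (there here)

-- Removing the factors x and x + 1

oddPart-cong : ∀ {p q} → p ≈ q → oddPart p ≡ oddPart q
oddPart-cong e = cong (λ r → stripFuel (length r) r) (≈⇒norm≡ e)

oddPart-false∷ : ∀ p → oddPart (false ∷ p) ≡ oddPart p
oddPart-false∷ p with norm p | norm-∷ false p
... | []    | eq rewrite eq = refl
... | _ ∷ _ | eq rewrite eq = refl

x⊗≈false∷ : ∀ p → x ⊗ p ≈ false ∷ p
x⊗≈false∷ p = ≈-trans (⊗≈mulRaw x p) (cons (addRaw-zeroʳ p (false∷ [])))

oddPart-x⊗ : ∀ p → oddPart (x ⊗ p) ≡ oddPart p
oddPart-x⊗ p = trans (oddPart-cong (x⊗≈false∷ p)) (oddPart-false∷ p)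

-- The last coefficient of prefixXor c q is c xor eval1 q; when it vanishes, norm drops it.
length-prefixXor : ∀ c q → c xor eval1 q ≡ false → length (norm (prefixXor c q)) ≤ length q ∸ 1
length-prefixXor c [] _ = z≤n
length-prefixXor c (a ∷ []) e rewrite Bool.xor-identityʳ a | e = z≤n
length-prefixXor c (a ∷ b ∷ q) e = begin
  length (norm (prefixXor c (a ∷ b ∷ q)))   ≡⟨ cong length (norm-∷ (c xor a) tail) ⟩
  length ((c xor a) ∷⁺ norm tail)           ≤⟨ length-∷⁺ (c xor a) (norm tail) ⟩
  suc (length (norm tail))                  ≤⟨ s≤s (length-prefixXor (c xor a) (b ∷ q) e′) ⟩
  suc (length q)                            ∎
  where
  open ℕ.≤-Reasoning
  tail : Poly
  tail = prefixXor (c xor a) (b ∷ q)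
  e′ : (c xor a) xor eval1 (b ∷ q) ≡ false
  e′ = trans (Bool.xor-assoc c a _) e
  length-∷⁺ : ∀ a p → length (a ∷⁺ p) ≤ suc (length p)
  length-∷⁺ true  []      = ℕ.≤-refl
  length-∷⁺ false []      = z≤n
  length-∷⁺ a     (_ ∷ _) = ℕ.≤-refl

length-divX+1 : ∀ p → eval1 (true ∷ p) ≡ false → length (divX+1 (true ∷ p)) ≤ length p
length-divX+1 p = length-prefixXor false (true ∷ p)

stripFuel-fuel : ∀ f g p → length p ≤ f → length p ≤ g → stripFuel f p ≡ stripFuel g p
stripFuel-fuel zero    zero    []      _ _ = refl
stripFuel-fuel zero    (suc g) []      _ _ = refl
stripFuel-fuel (suc f) zero    []      _ _ = refl
stripFuel-fuel (suc f) (suc g) []      _ _ = refl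
stripFuel-fuel (suc f) (suc g) (false ∷ p) (s≤s p≤f) (s≤s p≤g) = stripFuel-fuel f g p p≤f p≤g
stripFuel-fuel (suc f) (suc g) (true ∷ p) (s≤s p≤f) (s≤s p≤g) with eval1 (true ∷ p) in eq
... | true  = refl
... | false = stripFuel-fuel f g (divX+1 (true ∷ p))
                (ℕ.≤-trans (length-divX+1 p eq) p≤f) (ℕ.≤-trans (length-divX+1 p eq) p≤g)

prefixXor-IsZero : ∀ {z} → IsZero z → IsZero (prefixXor false z)
prefixXor-IsZero [] = []
prefixXor-IsZero (false∷ z) = false∷ prefixXor-IsZero z

prefixXor-resp-≈ : ∀ c {p q} → p ≈ q → c xor eval1 p ≡ false → prefixXor c p ≈ prefixXor c q
prefixXor-resp-≈ c ([]≈ z) e rewrite trans (sym (Bool.xor-identityʳ c)) e =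
  []≈ (prefixXor-IsZero z)
prefixXor-resp-≈ c (≈[] z) e rewrite eval1-IsZero z | trans (sym (Bool.xor-identityʳ c)) e =
  ≈[] (prefixXor-IsZero z)
prefixXor-resp-≈ c (cons {a} e) h =
  cons (prefixXor-resp-≈ (c xor a) e (trans (Bool.xor-assoc c a _) h))

xor-cancel : ∀ c a → c xor (a xor c) ≡ a
xor-cancel c a = trans (cong (c xor_) (Bool.xor-comm a c))
                       (trans (sym (Bool.xor-assoc c c a)) (cong (_xor a) (Bool.xor-same c)))

-- addRaw p (false ∷ p) is (x + 1) p; the carry c generalises the induction.
prefixXor-x+1 : ∀ c p → prefixXor c (addRaw p (c ∷ p)) ≈ p
prefixXor-x+1 c [] rewrite Bool.xor-same c = ≈[] (false∷ [])
prefixXor-x+1 c (a ∷ p) rewrite xor-cancel c a = cons (prefixXor-x+1 a p)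

divX+1-x+1⊗ : ∀ p → divX+1 (x+1 ⊗ p) ≡ norm p
divX+1-x+1⊗ p = ≈⇒norm≡ (begin
  prefixXor false (x+1 ⊗ p)              ≈⟨ prefixXor-resp-≈ false x+1p≈ (eval1-⊗ x+1 p) ⟩
  prefixXor false (addRaw p (false ∷ p))  ≈⟨ prefixXor-x+1 false p ⟩
  p                                       ∎)
  where
  open ≈-Reasoning
  x+1p≈ : x+1 ⊗ p ≈ addRaw p (false ∷ p)
  x+1p≈ = ≈-trans (⊗≈mulRaw x+1 p) (addRaw-cong (≈-refl {p}) (cons (addRaw-zeroʳ p (false∷ []))))

oddPart-unit : ∀ p → eval0 p ≡ true → eval1 p ≡ true → oddPart p ≡ norm p
oddPart-unit p e0 e1 with norm p | norm≈ p
... | [] | n≈p with () ← trans (eval0-resp-≈ n≈p) e0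
... | false ∷ _ | n≈p with () ← trans (eval0-resp-≈ n≈p) e0
... | true ∷ r | n≈p with eval1 (true ∷ r) | trans (eval1-resp-≈ n≈p) e1
...   | .true | refl = refl

divX+1-resp-≈ : ∀ {p q} → p ≈ q → eval1 p ≡ false → divX+1 p ≈ divX+1 q
divX+1-resp-≈ e e1 =
  ≈-trans (norm≈ _) (≈-trans (prefixXor-resp-≈ false e e1) (≈-sym (norm≈ _)))

oddPart-divX+1 : ∀ p → eval0 p ≡ true → eval1 p ≡ false → oddPart p ≡ oddPart (divX+1 p)
oddPart-divX+1 p e0 e1 with norm p | norm≈ p
... | [] | n≈p with () ← trans (eval0-resp-≈ n≈p) e0
... | false ∷ _ | n≈p with () ← trans (eval0-resp-≈ n≈p) e0
... | true ∷ r | n≈p with eval1 (true ∷ r) in eq | trans (eval1-resp-≈ n≈p) e1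
...   | .false | refl = begin
  stripFuel (length r) d     ≡⟨ stripFuel-fuel _ _ d (length-divX+1 r eq) ℕ.≤-refl ⟩
  stripFuel (length d) d
    ≡⟨ cong (λ s → stripFuel (length s) s) (norm-idem (prefixXor false (true ∷ r))) ⟨
  oddPart d                  ≡⟨ oddPart-cong (divX+1-resp-≈ n≈p eq) ⟩
  oddPart (divX+1 p)         ∎
  where
  open ≡-Reasoning
  d : Poly
  d = divX+1 (true ∷ r)

oddPart-x+1⊗ : ∀ p → oddPart (x+1 ⊗ p) ≡ oddPart p
oddPart-x+1⊗ [] = refl
oddPart-x+1⊗ (false ∷ p) = begin
  oddPart (x+1 ⊗ (false ∷ p))   ≡⟨ oddPart-cong x+1⊗false∷ ⟩
  oddPart (false ∷ (x+1 ⊗ p))   ≡⟨ oddPart-false∷ (x+1 ⊗ p) ⟩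
  oddPart (x+1 ⊗ p)             ≡⟨ oddPart-x+1⊗ p ⟩
  oddPart p                     ≡⟨ oddPart-false∷ p ⟨
  oddPart (false ∷ p)           ∎
  where
  open ≡-Reasoning
  x+1⊗false∷ : x+1 ⊗ (false ∷ p) ≈ false ∷ (x+1 ⊗ p)
  x+1⊗false∷ = ≈-trans (⊗≈mulRaw x+1 (false ∷ p))
                 (≈-trans (mulRaw-∷ʳ x+1 false p) (cons (≈-sym (⊗≈mulRaw x+1 p))))
oddPart-x+1⊗ (true ∷ p) = begin
  oddPart (x+1 ⊗ (true ∷ p))
    ≡⟨ oddPart-divX+1 (x+1 ⊗ (true ∷ p)) (eval0-⊗ x+1 (true ∷ p)) (eval1-⊗ x+1 (true ∷ p)) ⟩
  oddPart (divX+1 (x+1 ⊗ (true ∷ p)))     ≡⟨ cong oddPart (divX+1-x+1⊗ (true ∷ p)) ⟩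
  oddPart (norm (true ∷ p))               ≡⟨ oddPart-cong (norm≈ (true ∷ p)) ⟩
  oddPart (true ∷ p)                      ∎
  where open ≡-Reasoning

oddPart-D⊗ : ∀ p → oddPart (D ⊗ p) ≡ oddPart p
oddPart-D⊗ p = begin
  oddPart (D ⊗ p)               ≡⟨ oddPart-cong (⊗-assoc x x+1 p) ⟩
  oddPart (x ⊗ (x+1 ⊗ p))       ≡⟨ oddPart-x⊗ (x+1 ⊗ p) ⟩
  oddPart (x+1 ⊗ p)             ≡⟨ oddPart-x+1⊗ p ⟩
  oddPart p                     ∎
  where open ≡-Reasoning

oddPart-D^⊗ : ∀ m p → oddPart ((D ^ᵖ m) ⊗ p) ≡ oddPart p
oddPart-D^⊗ zero p = oddPart-cong (⊗-identityˡ p)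
oddPart-D^⊗ (suc m) p = begin
  oddPart ((D ⊗ (D ^ᵖ m)) ⊗ p)  ≡⟨ oddPart-cong (⊗-assoc D (D ^ᵖ m) p) ⟩
  oddPart (D ⊗ ((D ^ᵖ m) ⊗ p))  ≡⟨ oddPart-D⊗ ((D ^ᵖ m) ⊗ p) ⟩
  oddPart ((D ^ᵖ m) ⊗ p)        ≡⟨ oddPart-D^⊗ m p ⟩
  oddPart p                     ∎
  where open ≡-Reasoning

-- Collatz orbits through 1 + M^k D^e R

collatzOdd-shift : ∀ {A B i j} → collatzOdd A i ≡ collatzOdd B j →
                   ∀ k → collatzOdd A (k + i) ≡ collatzOdd B (k + j)
collatzOdd-shift e zero = e
collatzOdd-shift e (suc k) = cong (λ g → oddPart (one ⊕ (M ⊗ g))) (collatzOdd-shift e k)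

LengthIs-prepend : ∀ {A B} V L → (∀ k → k < V → collatzOdd A k ≢ one) →
                   collatzOdd A V ≡ collatzOdd B 0 → LengthIs B (suc L) → LengthIs A (suc (L + V))
LengthIs-prepend {A} {B} V L early A[V]≡B[0] (B[L]≡1 , B-early) = trans (shifted L) B[L]≡1 , A-early
  where
  shifted : ∀ k → collatzOdd A (k + V) ≡ collatzOdd B k
  shifted k = trans (collatzOdd-shift A[V]≡B[0] k) (cong (collatzOdd B) (ℕ.+-identityʳ k))
  A-early : ∀ k → k < L + V → collatzOdd A k ≢ one
  A-early k k<L+V with k <? V
  ... | yes k<V = early k k<V
  ... | no k≮V with k ∸ V | ℕ.m∸n+n≡m (ℕ.≮⇒≥ k≮V)
  ...   | o | refl = subst (_≢ one) (sym (shifted o)) (B-early o (ℕ.+-cancelʳ-< V o L k<L+V))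

-- Inside a block the odd terms have the shape 1 + M^k D^e R.
Γ : Poly → ℕ → ℕ → Poly
Γ R k e = one ⊕ ((M ^ᵖ k) ⊗ ((D ^ᵖ e) ⊗ R))

Γ-oddPart : ∀ R k e → oddPart (Γ R k (suc e)) ≡ Γ R k (suc e)
Γ-oddPart R k e = trans (oddPart-unit (Γ R k (suc e)) eval0-Γ eval1-Γ) (norm-idem (addRaw one X))
  where
  X : Poly
  X = (M ^ᵖ k) ⊗ ((D ^ᵖ suc e) ⊗ R)
  eval0-Γ : eval0 (Γ R k (suc e)) ≡ true
  eval0-Γ rewrite eval0-⊕ one X | eval0-⊗ (M ^ᵖ k) ((D ^ᵖ suc e) ⊗ R) | eval0-⊗ (D ^ᵖ suc e) R
                | eval0-⊗ D (D ^ᵖ e) | Bool.∧-zeroʳ (eval0 (M ^ᵖ k)) = refl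
  eval1-Γ : eval1 (Γ R k (suc e)) ≡ true
  eval1-Γ rewrite eval1-⊕ one X | eval1-⊗ (M ^ᵖ k) ((D ^ᵖ suc e) ⊗ R) | eval1-⊗ (D ^ᵖ suc e) R
                | eval1-⊗ D (D ^ᵖ e) | Bool.∧-zeroʳ (eval1 (M ^ᵖ k)) = refl

-- As 1 + M = D, a step turns one factor D inside Γ into a factor M and one in front.
Γ-step : ∀ R k e → one ⊕ (M ⊗ Γ R k (suc e)) ≈ D ⊗ Γ R (suc k) e
Γ-step R k e =
  solve 4 (λ d m dₑ r → con one :+ (con one :+ d) :* (con one :+ m :* ((d :* dₑ) :* r))
                      := d :* (con one :+ ((con one :+ d) :* m) :* (dₑ :* r)))
          ≈-refl D (M ^ᵖ k) (D ^ᵖ e) R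
  where open F₂[x]-Solver

Γ-≢one : ∀ {R} → R ≉0 → ∀ k e → Γ R k e ≢ one
Γ-≢one {R} R≉0 k e Γ≡one =
  ⊗-≉0 (^ᵖ-≉0 k M≉0) (⊗-≉0 (^ᵖ-≉0 e D≉0) R≉0) (⊕-cancelˡ one _ (≡⇒≈ Γ≡one))

trajectory : ∀ {A R n} d e → d + e ≡ n → collatzOdd A 0 ≡ oddPart (Γ R 0 n) →
             collatzOdd A d ≡ oddPart (Γ R d e)
trajectory zero e refl start = start
trajectory {A} {R} (suc d) e d+e≡n start = begin
  oddPart (one ⊕ (M ⊗ collatzOdd A d))   ≡⟨ cong (λ g → oddPart (one ⊕ (M ⊗ g))) A[d]≡Γ ⟩
  oddPart (one ⊕ (M ⊗ Γ R d (suc e)))    ≡⟨ oddPart-cong (Γ-step R d e) ⟩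
  oddPart (D ⊗ Γ R (suc d) e)            ≡⟨ oddPart-D⊗ (Γ R (suc d) e) ⟩
  oddPart (Γ R (suc d) e)                ∎
  where
  open ≡-Reasoning
  A[d]≡Γ : collatzOdd A d ≡ Γ R d (suc e)
  A[d]≡Γ = trans (trajectory d (suc e) (trans (ℕ.+-suc d e) d+e≡n) start) (Γ-oddPart R d e)

LengthIs-block : ∀ {A B R} V L → R ≉0 →
                 collatzOdd A 0 ≡ oddPart (Γ R 0 V) → collatzOdd B 0 ≡ oddPart (Γ R V 0) →
                 LengthIs B (suc L) → LengthIs A (suc (L + V))
LengthIs-block {A} {B} {R} V L R≉0 A-start B-start =
  LengthIs-prepend V L early (trans (trajectory V 0 (ℕ.+-identityʳ V) A-start) (sym B-start))
  where
  early : ∀ k → k < V → collatzOdd A k ≢ one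
  early k k<V = subst (_≢ one) (sym A[k]≡Γ) (Γ-≢one R≉0 k (suc c))
    where
    c : ℕ
    c = V ∸ suc k
    A[k]≡Γ : collatzOdd A k ≡ Γ R k (suc c)
    A[k]≡Γ = trans (trajectory k (suc c) (trans (ℕ.+-suc k c) (ℕ.m+[n∸m]≡n k<V)) A-start)
                   (Γ-oddPart R k c)

-- The orbit of M^n + 1 for an odd multiple n = 2^v (2t + 1) with t ≥ 1

module Block (v q : ℕ) where
  open ≈-Reasoning
  open F₂[x]-Solver
  V t : ℕ
  V = 2 ^ v
  t = suc q

  W w U S R : Poly
  W = M ^ᵖ V
  w = D ^ᵖ V
  U = W ^ᵖ 2
  S = geometric U t
  R = W ⊗ S

  W≈1⊕w : W ≈ one ⊕ w
  W≈1⊕w = ≈-trans (frobenius v one D) (⊕-cong (one-^ᵖ V) (≈-refl {w}))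

  U≈W⊗W : U ≈ W ⊗ W
  U≈W⊗W = ^ᵖ-square W

  1⊕U≈w⊗w : one ⊕ U ≈ w ⊗ w
  1⊕U≈w⊗w = begin
    one ⊕ U                         ≈⟨ ⊕-cong (≈-refl {one}) (≈-trans U≈W⊗W (⊗-cong W≈1⊕w W≈1⊕w)) ⟩
    one ⊕ ((one ⊕ w) ⊗ (one ⊕ w))   ≈⟨ solve 1 (λ w → con one :+ (con one :+ w) :* (con one :+ w)
                                                    := w :* w) ≈-refl w ⟩
    w ⊗ w                           ∎

  M^V[2t+1]≈ : M ^ᵖ (V * suc (2 * t)) ≈ W ⊗ (U ^ᵖ t)
  M^V[2t+1]≈ = begin
    M ^ᵖ (V * suc (2 * t))     ≈⟨ ^ᵖ-assocʳ M V (suc (2 * t)) ⟨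
    W ⊗ (W ^ᵖ (2 * t))         ≈⟨ ⊗-cong (≈-refl {W}) (^ᵖ-assocʳ W 2 t) ⟨
    W ⊗ (U ^ᵖ t)               ∎

  M^V[2t+2]≈ : M ^ᵖ (V * (2 * suc t)) ≈ U ^ᵖ suc t
  M^V[2t+2]≈ = begin
    M ^ᵖ (V * (2 * suc t))     ≈⟨ ^ᵖ-assocʳ M V (2 * suc t) ⟨
    W ^ᵖ (2 * suc t)           ≈⟨ ^ᵖ-assocʳ W 2 (suc t) ⟨
    U ^ᵖ suc t                 ∎

  w≈1⊕W : w ≈ one ⊕ W
  w≈1⊕W = begin
    w                  ≈⟨ solve 1 (λ w → w := con one :+ (con one :+ w)) ≈-refl w ⟩
    one ⊕ (one ⊕ w)    ≈⟨ ⊕-cong (≈-refl {one}) W≈1⊕w ⟨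
    one ⊕ W            ∎

  A≈w⊗Γ : (M ^ᵖ (V * suc (2 * t))) ⊕ one ≈ w ⊗ Γ R 0 V
  A≈w⊗Γ = begin
    (M ^ᵖ (V * suc (2 * t))) ⊕ one     ≈⟨ ⊕-cong M^V[2t+1]≈ (≈-refl {one}) ⟩
    (W ⊗ Uᵗ) ⊕ one                     ≈⟨ solve 2 (λ W Uᵗ → W :* Uᵗ :+ con one
                                                := (con one :+ W) :+ W :* (con one :+ Uᵗ)) ≈-refl W Uᵗ ⟩
    (one ⊕ W) ⊕ (W ⊗ (one ⊕ Uᵗ))
      ≈⟨ ⊕-cong w≈1⊕W (⊗-cong (≈-refl {W}) (geometric-sum U t)) ⟨
    w ⊕ (W ⊗ ((one ⊕ U) ⊗ S))
      ≈⟨ ⊕-cong (≈-refl {w}) (⊗-cong (≈-refl {W}) (⊗-cong 1⊕U≈w⊗w ≈-refl)) ⟩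
    w ⊕ (W ⊗ ((w ⊗ w) ⊗ S))            ≈⟨ solve 3 (λ w W S → w :+ W :* ((w :* w) :* S)
                                                := w :* (con one :+ con one :* (w :* (W :* S)))) ≈-refl w W S ⟩
    w ⊗ Γ R 0 V                        ∎
    where
    Uᵗ : Poly
    Uᵗ = U ^ᵖ t

  B≈w⊗w⊗Γ : (M ^ᵖ (V * (2 * suc t))) ⊕ one ≈ w ⊗ (w ⊗ Γ R V 0)
  B≈w⊗w⊗Γ = begin
    (M ^ᵖ (V * (2 * suc t))) ⊕ one     ≈⟨ ⊕-cong M^V[2t+2]≈ (≈-refl {one}) ⟩
    (U ⊗ (U ^ᵖ t)) ⊕ one               ≈⟨ ⊕-comm (U ⊗ (U ^ᵖ t)) one ⟩
    one ⊕ (U ⊗ (U ^ᵖ t))               ≈⟨ geometric-sum U (suc t) ⟨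
    (one ⊕ U) ⊗ (one ⊕ (U ⊗ S))
      ≈⟨ ⊗-cong 1⊕U≈w⊗w (⊕-cong (≈-refl {one}) (⊗-cong U≈W⊗W ≈-refl)) ⟩
    (w ⊗ w) ⊗ (one ⊕ ((W ⊗ W) ⊗ S))    ≈⟨ solve 3 (λ w W S → (w :* w) :* (con one :+ (W :* W) :* S)
                                                := w :* (w :* (con one :+ W :* (con one :* (W :* S)))))
                                              ≈-refl w W S ⟩
    w ⊗ (w ⊗ Γ R V 0)                  ∎

  evalω-U : evalω U ≡ (false , false)
  evalω-U rewrite evalω-⊗ W (W ⊗ one) | evalω-M^ V (ℕ.m^n>0 2 v) = refl

  R≉0 : R ≉0
  R≉0 = ⊗-≉0 (^ᵖ-≉0 V M≉0) S≉0
    where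
    evalω-S : evalω S ≡ (true , false)
    evalω-S rewrite evalω-⊕ one (U ⊗ geometric U q) | evalω-⊗ U (geometric U q) | evalω-U = refl
    S≉0 : S ≉0
    S≉0 S≈0 with () ← trans (sym evalω-S) (evalω-resp-≈ S≈0)

  A B : Poly
  A = (M ^ᵖ (V * suc (2 * t))) ⊕ one
  B = (M ^ᵖ (V * (2 * suc t))) ⊕ one

  A-start : collatzOdd A 0 ≡ oddPart (Γ R 0 V)
  A-start = trans (oddPart-cong (≈-trans (norm≈ A) A≈w⊗Γ)) (oddPart-D^⊗ V (Γ R 0 V))

  B-start : collatzOdd B 0 ≡ oddPart (Γ R V 0)
  B-start = trans (oddPart-cong (≈-trans (norm≈ B) B≈w⊗w⊗Γ))
                  (trans (oddPart-D^⊗ V (w ⊗ Γ R V 0)) (oddPart-D^⊗ V (Γ R V 0)))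

-- PowLength n L says that ℓ (M ^ n + 1) = 1 + L.
PowLength : ℕ → ℕ → Set
PowLength n L = LengthIs ((M ^ᵖ n) ⊕ one) (suc L)

PowLength-block : ∀ v q L → PowLength (2 ^ v * (2 * suc (suc q))) L →
                  PowLength (2 ^ v * suc (2 * suc q)) (L + 2 ^ v)
PowLength-block v q L = LengthIs-block V L R≉0 A-start B-start
  where open Block v q

PowLength-2^ : ∀ v → PowLength (2 ^ v) 0
PowLength-2^ v = trans (oddPart-cong (≈-trans (norm≈ _) A≈)) (oddPart-D^⊗ V one) , λ _ ()
  where
  open ≈-Reasoning
  open F₂[x]-Solver
  V : ℕ
  V = 2 ^ v
  A≈ : (M ^ᵖ V) ⊕ one ≈ (D ^ᵖ V) ⊗ one
  A≈ = begin
    (M ^ᵖ V) ⊕ one                     ≈⟨ ⊕-cong (frobenius v one D) (≈-refl {one}) ⟩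
    ((one ^ᵖ V) ⊕ (D ^ᵖ V)) ⊕ one
      ≈⟨ ⊕-cong (⊕-cong (one-^ᵖ V) (≈-refl {D ^ᵖ V})) (≈-refl {one}) ⟩
    (one ⊕ (D ^ᵖ V)) ⊕ one             ≈⟨ solve 1 (λ d → (con one :+ d) :+ con one := d :* con one)
                                                ≈-refl (D ^ᵖ V) ⟩
    (D ^ᵖ V) ⊗ one                     ∎

-- Subtracting i < 2^v from an exponent divisible by 2^v, one binary digit of i at a time.
PowLength-countdown : ∀ v q i L → i < 2 ^ v → PowLength ((2 + q) * 2 ^ v) L →
                      PowLength ((2 + q) * 2 ^ v ∸ i) (L + i)
PowLength-countdown zero q zero L _ h = subst (PowLength ((2 + q) * 1)) (sym (ℕ.+-identityʳ L)) h
PowLength-countdown zero q (suc i) L (s≤s ()) h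
PowLength-countdown (suc v) q i L i<2V h with i <? 2 ^ v
... | yes i<V =
  subst (λ n → PowLength (n ∸ i) (L + i)) 2V-even
    (PowLength-countdown v (q + (2 + q)) i L i<V (subst (λ n → PowLength n L) (sym 2V-even) h))
  where
  2V-even : (2 + (q + (2 + q))) * 2 ^ v ≡ (2 + q) * 2 ^ suc v
  2V-even = solve 2 (λ q V → (con 2 :+ (q :+ (con 2 :+ q))) :* V := (con 2 :+ q) :* (con 2 :* V))
                    refl q (2 ^ v)
    where open +-*-Solver
... | no i≮V with i ∸ 2 ^ v | ℕ.m+[n∸m]≡n (ℕ.≮⇒≥ i≮V)
...   | j | refl =
  subst₂ PowLength exponent (ℕ.+-assoc L V j)
    (PowLength-countdown v q′ j (L + V) j<V
      (subst (λ n → PowLength n (L + V)) odd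
        (PowLength-block v q L (subst (λ n → PowLength n L) even h))))
  where
  open +-*-Solver
  V q′ : ℕ
  V = 2 ^ v
  q′ = suc (2 * q)
  j<V : j < V
  j<V = ℕ.+-cancelˡ-< V j V (subst (V + j <_) (cong (V +_) (ℕ.+-identityʳ V)) i<2V)
  even : (2 + q) * 2 ^ suc v ≡ V * (2 * suc (suc q))
  even = solve 2 (λ q V → (con 2 :+ q) :* (con 2 :* V) := V :* (con 2 :* (con 2 :+ q))) refl q V
  odd : V * suc (2 * suc q) ≡ (2 + q′) * V
  odd = solve 2 (λ q V → V :* (con 1 :+ con 2 :* (con 1 :+ q)) := (con 3 :+ con 2 :* q) :* V) refl q V
  split : (2 + q′) * V + V ≡ (2 + q) * 2 ^ suc v
  split = solve 2 (λ q V → (con 3 :+ con 2 :* q) :* V :+ V := (con 2 :+ q) :* (con 2 :* V)) refl q V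
  exponent : (2 + q′) * V ∸ j ≡ (2 + q) * 2 ^ suc v ∸ (V + j)
  exponent = begin
    (2 + q′) * V ∸ j                  ≡⟨ cong (_∸ j) (ℕ.m+n∸n≡m ((2 + q′) * V) V) ⟨
    (2 + q′) * V + V ∸ V ∸ j          ≡⟨ cong (λ n → n ∸ V ∸ j) split ⟩
    (2 + q) * 2 ^ suc v ∸ V ∸ j       ≡⟨ ℕ.∸-+-assoc ((2 + q) * 2 ^ suc v) V j ⟩
    (2 + q) * 2 ^ suc v ∸ (V + j)     ∎
    where open ≡-Reasoning

m≤n∸1⇒m<n : ∀ {m n} → 0 < n → m ≤ n ∸ 1 → m < n
m≤n∸1⇒m<n {n = suc n} _ m≤n = s≤s m≤n

proposition3p7 : (r j : ℕ) → 1 ≤ r → j ≤ 2 ^ (r ∸ 1) ∸ 1 →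
    LengthIs ((M ^ᵖ (2 ^ r ∸ j)) ⊕ one) (suc j)
proposition3p7 (suc v) j _ j≤2^v∸1 =
  PowLength-countdown v 0 j 0 (m≤n∸1⇒m<n (ℕ.m^n>0 2 v) j≤2^v∸1) (PowLength-2^ (suc v))
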